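{- Let $\varphi$ be an h-inductive sentence and let $\prod_{x\in X}M_x/F$ be a prime product (of an ordered system $\{M_x\mid x\in X\}$ indexed by a wellfounded forest $\mathbb{X}$, with $F$ a prime filter over $\mathbb{X}$) such that $M_x\vDash\varphi$ for every $x\in X$. Then $\prod_{x\in X}M_x/F\vDash\varphi$.
   Context: A positive formula is built from atomic formulas and $\bot$ using only $\exists,\land,\lor$. A basic h-inductive formula has the form $\forall v_1,\dots,v_n(\psi_1\to\psi_2)$ with $\psi_1,\psi_2$ positive; an h-inductive formula is a conjunction of basic h-inductive formulas. Upsets of a poset are upward closed subsets, forming the lattice $\mathsf{Up}(\mathbb{X})$. A filter over $\mathbb{X}$ is a nonempty subset of $\mathsf{Up}(\mathbb{X})$ upward closed under inclusion and closed under binary intersections; it is prime if proper and $V\cup W\in F$ implies $V\in F$ or $W\in F$. A wellfounded forest is a poset whose principal downsets are well ordered. An ordered system indexed by $\mathbb{X}$: similar structures $M_x$ with homomorphisms $f_{xy}\colon M_x\to M_y$ ($x\le y$), $f_{xx}=\mathrm{id}$, $f_{xz}=f_{yz}\circ f_{xy}$. With $F$ a filter: $S_V=\{a\in\prod_{x\in V}M_x\mid y\le z\in V\Rightarrow f_{yz}(a(y))=a(z)\}$ for $V\in F$, $S_F=\bigcup_{V\in F}S_V$, $V_a$ the domain of $a$, $\llbracket\varphi(a_1,\dots,a_n)\rrbracket=\{x\in\bigcap_iV_{a_i}\mid M_x\vDash\varphi(a_1(x),\dots,a_n(x))\}$, $a\equiv_Fb$ iff $\llbracket a=b\rrbracket\in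 F$. The product $\prod_xM_x/F$ has universe $S_F/{\equiv_F}$, operations computed coordinatewise on the intersection of the domains, and basic relations $R$ holding of $(a_i/{\equiv_F})_i$ iff $\llbracket R(a_1,\dots,a_n)\rrbracket\in F$; it is a prime product when $F$ is prime. -}

module Defs where

open import Level using (Level; _⊔_; 0ℓ; Lift; lift) renaming (suc to lsuc)
open import Data.Nat using (ℕ; suc)
open import Data.Fin using (Fin; zero; suc)
open import Data.Vec using (Vec; []; _∷_; map)
open import Data.Unit using (⊤; tt)
open import Data.List using (List)
import Data.List.Relation.Unary.All as LAll
open import Data.Product using (Σ; _×_; _,_; proj₁; proj₂)
open import Data.Sum using (_⊎_; inj₁; inj₂)
open import Data.Empty using (⊥)
open import Relation.Nullary using (¬_)
open import Relation.Binary.PropositionalEquality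
  using (_≡_; _≢_; refl; cong; cong₂; subst; trans; sym)
open import Induction.WellFounded using (WellFounded)

record Signature : Set₁ where
  field
    FunSym : Set
    funAr  : FunSym → ℕ
    RelSym : Set
    relAr  : RelSym → ℕ

module Syntax (L : Signature) where
  open Signature L

  -- terms with free variables among Fin n (de Bruijn, variable zero is
  -- the most recently bound one)
  data Term (n : ℕ) : Set where
    var : Fin n → Term n
    fun : (g : FunSym) → Vec (Term n) (funAr g) → Term n

  data Pos (n : ℕ) : Set where
    _≐_  : Term n → Term n → Pos n
    rel  : (R : RelSym) → Vec (Term n) (relAr R) → Pos n
    ⊥ᵖ   : Pos n
    _∧ᵖ_ : Pos n → Pos n → Pos n
    _∨ᵖ_ : Pos n → Pos n → Pos n
    ∃ᵖ   : Pos (suc n) → Pos n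

  -- basic h-inductive sentence  ∀ v₁ … v_arity (hyp → concl)
  record BasicHInd : Set where
    field
      arity : ℕ
      hyp   : Pos arity
      concl : Pos arity

  -- h-inductive sentence: a (finite) conjunction of basic ones
  HInd : Set
  HInd = List BasicHInd

  -- Structures
  -- "presented by a setoid" interpret = by a given relation _≈_; these
  -- are used to present quotient structures (no quotient types here).

  record Structure : Set₁ where
    field
      Carrier : Set
      fn : (g : FunSym) → Vec Carrier (funAr g) → Carrier
      rl : (R : RelSym) → Vec Carrier (relAr R) → Set

  record SetoidStructure (a ℓ : Level) : Set (lsuc (a ⊔ ℓ)) where
    field
      Carrier : Set a
      _≈_ : Carrier → Carrier → Set ℓ
      fn : (g : FunSym) → Vec Carrier (funAr g) → Carrier
      rl : (R : RelSym) → Vec Carrier (relAr R) → Set ℓ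

  std : Structure → SetoidStructure 0ℓ 0ℓ
  std M = record
    { Carrier = Structure.Carrier M
    ; _≈_ = _≡_
    ; fn = Structure.fn M
    ; rl = Structure.rl M }

  record IsHom (M N : Structure) (h : Structure.Carrier M → Structure.Carrier N) : Set where
    field
      hom-fn : ∀ g (v : Vec (Structure.Carrier M) (funAr g)) →
               h (Structure.fn M g v) ≡ Structure.fn N g (map h v)
      hom-rl : ∀ R (v : Vec (Structure.Carrier M) (relAr R)) →
               Structure.rl M R v → Structure.rl N R (map h v)

  module Sat {a ℓ} (A : SetoidStructure a ℓ) where
    open SetoidStructure A

    Env : ℕ → Set a
    Env n = Fin n → Carrier

    extend : ∀ {n} → Carrier → Env n → Env (suc n)
    extend c ρ zero    = c
    extend c ρ (suc i) = ρ i

    mutual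
      ev : ∀ {n} → Env n → Term n → Carrier
      ev ρ (var i)    = ρ i
      ev ρ (fun g ts) = fn g (evs ρ ts)

      evs : ∀ {n k} → Env n → Vec (Term n) k → Vec Carrier k
      evs ρ []       = []
      evs ρ (t ∷ ts) = ev ρ t ∷ evs ρ ts

    sat : ∀ {n} → Env n → Pos n → Set (a ⊔ ℓ)
    sat ρ (t ≐ s)   = Lift a (ev ρ t ≈ ev ρ s)
    sat ρ (rel R ts) = Lift a (rl R (evs ρ ts))
    sat ρ ⊥ᵖ        = Lift (a ⊔ ℓ) ⊥
    sat ρ (φ ∧ᵖ ψ)  = sat ρ φ × sat ρ ψ
    sat ρ (φ ∨ᵖ ψ)  = sat ρ φ ⊎ sat ρ ψ
    sat ρ (∃ᵖ φ)    = Σ Carrier λ c → sat (extend c ρ) φ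

    satBasic : BasicHInd → Set (a ⊔ ℓ)
    satBasic β = (ρ : Env arity) → sat ρ hyp → sat ρ concl
      where open BasicHInd β

  _⊨_ : ∀ {a ℓ} → SetoidStructure a ℓ → HInd → Set (a ⊔ ℓ)
  A ⊨ φ = LAll.All (Sat.satBasic A) φ

module Order {X : Set} (_≤_ : X → X → Set) where

  record Upset : Set₁ where
    field
      pred : X → Set
      up   : ∀ {x y} → x ≤ y → pred x → pred y
  open Upset public

  _⊆_ : Upset → Upset → Set
  V ⊆ W = ∀ x → pred V x → pred W x

  _∩_ : Upset → Upset → Upset
  V ∩ W = record { pred = λ x → pred V x × pred W x
                 ; up = λ p q → up V p (proj₁ q) , up W p (proj₂ q) }

  _∪_ : Upset → Upset → Upset
  V ∪ W = record { pred = λ x → pred V x ⊎ pred W x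
                 ; up = λ { p (inj₁ q) → inj₁ (up V p q)
                          ; p (inj₂ q) → inj₂ (up W p q) } }

  ⊤ᵘ : Upset
  ⊤ᵘ = record { pred = λ _ → ⊤ ; up = λ _ _ → tt }

  record IsFilter (F : Upset → Set) : Set₁ where
    field
      nonempty : Σ Upset F
      upward   : ∀ V W → V ⊆ W → F V → F W
      meet     : ∀ V W → F V → F W → F (V ∩ W)

  record IsPrimeFilter (F : Upset → Set) : Set₁ where
    field
      isFilter : IsFilter F
      proper   : ¬ (∀ V → F V)
      prime    : ∀ V W → F (V ∪ W) → F V ⊎ F W

  Down : X → Set
  Down x = Σ X λ y → y ≤ x

  _<[_]_ : ∀ {x} → Down x → (x' : X) → Down x → Set
  a <[ _ ] b = (proj₁ a ≤ proj₁ b) × (proj₁ a ≢ proj₁ b)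

  record WellfoundedForest : Set where
    field
      total : ∀ x (a b : Down x) → (proj₁ a ≤ proj₁ b) ⊎ (proj₁ b ≤ proj₁ a)
      wf    : ∀ x → WellFounded (λ (a b : Down x) → a <[ x ] b)

module Systems (L : Signature) {X : Set} (_≤_ : X → X → Set) where
  open Syntax L
  open Signature L

  record OrderedSystem : Set₁ where
    field
      M     : X → Structure
      f     : ∀ {x y} → x ≤ y → Structure.Carrier (M x) → Structure.Carrier (M y)
      f-hom : ∀ {x y} (p : x ≤ y) → IsHom (M x) (M y) (f p)
      f-id  : ∀ {x} (p : x ≤ x) m → f p m ≡ m
      f-comp : ∀ {x y z} (p : x ≤ y) (q : y ≤ z) (r : x ≤ z) m →
               f r m ≡ f q (f p m)

  module Product (S : OrderedSystem) (F : Order.Upset _≤_ → Set)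
                 (isF : Order.IsFilter _≤_ F) where
    open OrderedSystem S
    open Order _≤_
    open IsFilter isF

    C : X → Set
    C x = Structure.Carrier (M x)

    -- elements of S_F: coherent partial sections with domain in F
    record Elem : Set₁ where
      field
        dom : Upset
        inF : F dom
        val : ∀ x → pred dom x → C x
        coh : ∀ {y z} (p : y ≤ z) (dy : pred dom y) (dz : pred dom z) →
              f p (val y dy) ≡ val z dz
    open Elem public

    ⊤∈F : F ⊤ᵘ
    ⊤∈F = upward (proj₁ nonempty) ⊤ᵘ (λ x _ → tt) (proj₂ nonempty)

    DomAll : ∀ {k} → Vec Elem k → X → Set
    DomAll [] x = ⊤
    DomAll (a ∷ as) x = pred (dom a) x × DomAll as x

    upAll : ∀ {k} (as : Vec Elem k) {x y} → x ≤ y → DomAll as x → DomAll as y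
    upAll [] p _ = tt
    upAll (a ∷ as) p (d , ds) = up (dom a) p d , upAll as p ds

    ⋂ : ∀ {k} → Vec Elem k → Upset
    ⋂ as = record { pred = DomAll as ; up = upAll as }

    ⋂∈F : ∀ {k} (as : Vec Elem k) → F (⋂ as)
    ⋂∈F [] = upward ⊤ᵘ (⋂ []) (λ _ _ → tt) ⊤∈F
    ⋂∈F (a ∷ as) = upward (dom a ∩ ⋂ as) (⋂ (a ∷ as)) (λ x q → q)
                          (meet (dom a) (⋂ as) (inF a) (⋂∈F as))

    evalAt : ∀ {k} x (as : Vec Elem k) → DomAll as x → Vec (C x) k
    evalAt x [] _ = []
    evalAt x (a ∷ as) (d , ds) = val a x d ∷ evalAt x as ds

    evalAt-coh : ∀ {k} (as : Vec Elem k) {x y} (p : x ≤ y)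
                 (ds : DomAll as x) (ds' : DomAll as y) →
                 map (f p) (evalAt x as ds) ≡ evalAt y as ds'
    evalAt-coh [] p _ _ = refl
    evalAt-coh (a ∷ as) p (d , ds) (d' , ds') =
      cong₂ _∷_ (coh a p d d') (evalAt-coh as p ds ds')

    ⟦_≐_⟧ : Elem → Elem → Upset
    ⟦ a ≐ b ⟧ = record
      { pred = λ x → Σ (pred (dom a) x) λ da → Σ (pred (dom b) x) λ db →
                     val a x da ≡ val b x db
      ; up = λ { p (da , db , e) →
                 let da' = up (dom a) p da ; db' = up (dom b) p db in
                 da' , db' ,
                 trans (sym (coh a p da da')) (trans (cong (f p) e) (coh b p db db')) } }

    ⟦rel_⟧ : (R : RelSym) → Vec Elem (relAr R) → Upset
    ⟦rel R ⟧ as = record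
      { pred = λ x → Σ (DomAll as x) λ ds → Structure.rl (M x) R (evalAt x as ds)
      ; up = λ { p (ds , r) →
                 let ds' = upAll as p ds in
                 ds' , subst (Structure.rl (M _) R) (evalAt-coh as p ds ds')
                             (IsHom.hom-rl (f-hom p) R _ r) } }

    fnP : (g : FunSym) → Vec Elem (funAr g) → Elem
    fnP g as = record
      { dom = ⋂ as
      ; inF = ⋂∈F as
      ; val = λ x ds → Structure.fn (M x) g (evalAt x as ds)
      ; coh = λ p dy dz → trans (IsHom.hom-fn (f-hom p) g _)
                                (cong (Structure.fn (M _) g) (evalAt-coh as p dy dz)) }

    -- the product ∏ M_x / F, presented as S_F with equality ≡_F
    ∏/F : SetoidStructure (lsuc 0ℓ) 0ℓ
    ∏/F = record
      { Carrier = Elem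
      ; _≈_ = λ a b → F ⟦ a ≐ b ⟧
      ; fn = fnP
      ; rl = λ R as → F (⟦rel R ⟧ as) }

{-# OPTIONS --safe #-}
-- A Łoś theorem for positive formulas.  For every positive ψ and tuple ρ of
-- the product, ψ holds of ρ in ∏ M_x / F iff its truth set ⟦ ψ ∣ ρ ⟧ lies in F.
-- Left to right needs only that F is a filter.  Right to left uses properness
-- for ⊥, primeness for ∨, and for ∃ a witness glued from local ones: below
-- each x in the truth set V of ∃ψ there is a least point m of V (the downset of
-- x is well ordered), a witness at m is pushed forward to x along f, and the
-- choice only depends on m.  An h-inductive sentence then transfers, since
-- ⟦ hyp ∣ ρ ⟧ ⊆ ⟦ concl ∣ ρ ⟧ when every factor satisfies hyp → concl.
module Submission where

open import Defs
open import Level using (0ℓ; Lift; lift; lower) renaming (suc to lsuc)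
open import Relation.Binary.PropositionalEquality
open import Relation.Binary.Structures using (IsPartialOrder)
open import Axiom.ExcludedMiddle using (ExcludedMiddle)
open import Data.Nat using (zero; suc)
open import Data.Fin using (Fin; zero; suc)
open import Data.Vec using (Vec; []; _∷_; map)
open import Data.Unit using (tt)
open import Data.Empty using (⊥-elim)
open import Data.Product using (Σ; _×_; _,_; proj₁; proj₂)
open import Data.Sum using (inj₁; inj₂)
open import Data.List using ([]; _∷_)
import Data.List.Relation.Unary.All as All
open import Relation.Nullary using (Dec; yes; no)
open import Relation.Nullary.Decidable using (map′)
open import Induction.WellFounded using (Acc; acc)

module Classical (em : ExcludedMiddle (lsuc 0ℓ)) where

  decide : (Q : Set) → Dec Q
  decide Q = map′ lower lift em

  -- With excluded middle every type has a constant endofunction; it makes a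
  -- witness extracted from a proof independent of that proof.
  private
    collapse′ : {Q : Set} → Dec Q → Q → Q
    collapse′ (yes q) _ = q
    collapse′ (no ¬q) q = ⊥-elim (¬q q)

    collapse′-constant : {Q : Set} (d : Dec Q) (q q′ : Q) → collapse′ d q ≡ collapse′ d q′
    collapse′-constant (yes _) _ _ = refl
    collapse′-constant (no ¬q) q _ = ⊥-elim (¬q q)

  collapse : {Q : Set} → Q → Q
  collapse {Q} = collapse′ (decide Q)

  collapse-constant : {Q : Set} (q q′ : Q) → collapse q ≡ collapse q′
  collapse-constant {Q} = collapse′-constant (decide Q)

module WellfoundedForestProperties
  {X : Set} {_≤_ : X → X → Set} (em : ExcludedMiddle (lsuc 0ℓ))
  (po : IsPartialOrder _≡_ _≤_) (wff : Order.WellfoundedForest _≤_) where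
  open Order _≤_
  open Order.WellfoundedForest wff
  open IsPartialOrder po using (antisym) renaming (refl to ≤-refl; trans to ≤-trans)
  open Classical em using (decide)

  record LeastBelow (P : X → Set) (x : X) : Set where
    field
      point   : X
      point≤x : point ≤ x
      holds   : P point
      least   : ∀ {y} → y ≤ x → P y → point ≤ y

  module _ (P : X → Set) where

    private
      leastBelowAcc : ∀ {x} (b : Down x) → Acc _<[ x ]_ b → P (proj₁ b) → LeastBelow P x
      leastBelowAcc {x} (b , b≤x) (acc below) Pb
        with decide (Σ (Down x) λ c → c <[ x ] (b , b≤x) × P (proj₁ c))
      ... | yes (c , c<b , Pc) = leastBelowAcc c (below c<b) Pc
      ... | no noSmaller = record { point = b ; point≤x = b≤x ; holds = Pb ; least = b≤ }
        where
          b≤ : ∀ {y} → y ≤ x → P y → b ≤ y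
          b≤ {y} y≤x Py with total x (b , b≤x) (y , y≤x)
          ... | inj₁ b≤y = b≤y
          ... | inj₂ y≤b with decide (y ≡ b)
          ...   | yes refl = ≤-refl
          ...   | no y≢b = ⊥-elim (noSmaller ((y , y≤x) , (y≤b , y≢b) , Py))

    leastBelow : ∀ {x} → P x → LeastBelow P x
    leastBelow {x} = leastBelowAcc (x , ≤-refl) (wf x (x , ≤-refl))

    leastBelow-unique : ∀ {y z} → y ≤ z → (Ly : LeastBelow P y) (Lz : LeastBelow P z) →
                        LeastBelow.point Ly ≡ LeastBelow.point Lz
    leastBelow-unique y≤z Ly Lz = antisym my≤mz mz≤my
      where
        open LeastBelow
        mz≤my : point Lz ≤ point Ly
        mz≤my = least Lz (≤-trans (point≤x Ly) y≤z) (holds Ly)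
        my≤mz : point Ly ≤ point Lz
        my≤mz = least Ly (≤-trans mz≤my (point≤x Ly)) (holds Lz)

module SatisfactionProperties (L : Signature) where
  open Syntax L

  module _ {a ℓ} (A : SetoidStructure a ℓ) where
    open SetoidStructure A
    open Sat A

    mutual
      ev-cong : ∀ {n} {ρ σ : Env n} → (∀ i → ρ i ≡ σ i) → ∀ t → ev ρ t ≡ ev σ t
      ev-cong ρ≡σ (var i) = ρ≡σ i
      ev-cong ρ≡σ (fun g ts) = cong (fn g) (evs-cong ρ≡σ ts)

      evs-cong : ∀ {n k} {ρ σ : Env n} → (∀ i → ρ i ≡ σ i) →
                 (ts : Vec (Term n) k) → evs ρ ts ≡ evs σ ts
      evs-cong ρ≡σ [] = refl
      evs-cong ρ≡σ (t ∷ ts) = cong₂ _∷_ (ev-cong ρ≡σ t) (evs-cong ρ≡σ ts)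

    sat-cong : ∀ {n} {ρ σ : Env n} → (∀ i → ρ i ≡ σ i) → ∀ ψ → sat ρ ψ → sat σ ψ
    sat-cong ρ≡σ (t ≐ s) (lift t≈s) = lift (subst₂ _≈_ (ev-cong ρ≡σ t) (ev-cong ρ≡σ s) t≈s)
    sat-cong ρ≡σ (rel R ts) (lift r) = lift (subst (rl R) (evs-cong ρ≡σ ts) r)
    sat-cong ρ≡σ ⊥ᵖ (lift ())
    sat-cong ρ≡σ (ψ ∧ᵖ χ) (sψ , sχ) = sat-cong ρ≡σ ψ sψ , sat-cong ρ≡σ χ sχ
    sat-cong ρ≡σ (ψ ∨ᵖ χ) (inj₁ sψ) = inj₁ (sat-cong ρ≡σ ψ sψ)
    sat-cong ρ≡σ (ψ ∨ᵖ χ) (inj₂ sχ) = inj₂ (sat-cong ρ≡σ χ sχ)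
    sat-cong {ρ = ρ} {σ} ρ≡σ (∃ᵖ ψ) (c , sψ) = c , sat-cong extended ψ sψ
      where
        extended : ∀ i → extend c ρ i ≡ extend c σ i
        extended zero = refl
        extended (suc i) = ρ≡σ i

  module _ {A B : Structure} {h : Structure.Carrier A → Structure.Carrier B}
           (isHom : IsHom A B h) where
    private
      module A = Sat (std A)
      module B = Sat (std B)

    mutual
      ev-hom : ∀ {n} (ρ : A.Env n) t → h (A.ev ρ t) ≡ B.ev (λ i → h (ρ i)) t
      ev-hom ρ (var i) = refl
      ev-hom ρ (fun g ts) =
        trans (IsHom.hom-fn isHom g _) (cong (Structure.fn B g) (evs-hom ρ ts))

      evs-hom : ∀ {n k} (ρ : A.Env n) (ts : Vec (Term n) k) →
                map h (A.evs ρ ts) ≡ B.evs (λ i → h (ρ i)) ts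
      evs-hom ρ [] = refl
      evs-hom ρ (t ∷ ts) = cong₂ _∷_ (ev-hom ρ t) (evs-hom ρ ts)

    sat-hom : ∀ {n} (ρ : A.Env n) ψ → A.sat ρ ψ → B.sat (λ i → h (ρ i)) ψ
    sat-hom ρ (t ≐ s) (lift t≡s) =
      lift (trans (sym (ev-hom ρ t)) (trans (cong h t≡s) (ev-hom ρ s)))
    sat-hom ρ (rel R ts) (lift r) =
      lift (subst (Structure.rl B R) (evs-hom ρ ts) (IsHom.hom-rl isHom R _ r))
    sat-hom ρ ⊥ᵖ (lift ())
    sat-hom ρ (ψ ∧ᵖ χ) (sψ , sχ) = sat-hom ρ ψ sψ , sat-hom ρ χ sχ
    sat-hom ρ (ψ ∨ᵖ χ) (inj₁ sψ) = inj₁ (sat-hom ρ ψ sψ)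
    sat-hom ρ (ψ ∨ᵖ χ) (inj₂ sχ) = inj₂ (sat-hom ρ χ sχ)
    sat-hom ρ (∃ᵖ ψ) (c , sψ) =
      h c , sat-cong (std B) extended ψ (sat-hom (A.extend c ρ) ψ sψ)
      where
        extended : ∀ i → h (A.extend c ρ i) ≡ B.extend (h c) (λ j → h (ρ j)) i
        extended zero = refl
        extended (suc i) = refl

module FilterProduct
  (L : Signature) {X : Set} {_≤_ : X → X → Set} (po : IsPartialOrder _≡_ _≤_)
  (S : Systems.OrderedSystem L _≤_) (F : Order.Upset _≤_ → Set)
  (isFilter : Order.IsFilter _≤_ F) where
  open Syntax L
  open Order _≤_
  open IsFilter isFilter
  open Systems.OrderedSystem S
  open Systems.Product L _≤_ S F isFilter
  open SatisfactionProperties L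
  open IsPartialOrder po using () renaming (refl to ≤-refl)

  module ∏ = Sat ∏/F

  module _ {x : X} where
    open Sat (std (M x)) public using () renaming (sat to sat-at; ev to ev-at; evs to evs-at)

  f-irrelevant : ∀ {x y} (p q : x ≤ y) m → f p m ≡ f q m
  f-irrelevant p q m = trans (f-comp ≤-refl q p m) (cong (f q) (f-id ≤-refl m))

  val-irrelevant : ∀ (a : Elem) x d d′ → val a x d ≡ val a x d′
  val-irrelevant a x d d′ = trans (sym (f-id ≤-refl _)) (coh a ≤-refl d d′)

  Dom : ∀ {n} → ∏.Env n → Upset
  Dom ρ = record { pred = λ x → ∀ i → pred (dom (ρ i)) x
                 ; up = λ x≤y d i → up (dom (ρ i)) x≤y (d i) }

  Dom∈F : ∀ {n} (ρ : ∏.Env n) → F (Dom ρ)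
  Dom∈F {zero} ρ = upward ⊤ᵘ (Dom ρ) (λ _ _ ()) ⊤∈F
  Dom∈F {suc n} ρ = upward (dom (ρ zero) ∩ Dom (λ i → ρ (suc i))) (Dom ρ) split
    (meet _ _ (inF (ρ zero)) (Dom∈F (λ i → ρ (suc i))))
    where
      split : (dom (ρ zero) ∩ Dom (λ i → ρ (suc i))) ⊆ Dom ρ
      split x (d₀ , d) zero = d₀
      split x (d₀ , d) (suc i) = d i

  coord : ∀ {n} (ρ : ∏.Env n) x → pred (Dom ρ) x → Fin n → C x
  coord ρ x d i = val (ρ i) x (d i)

  coord-irrelevant : ∀ {n} (ρ : ∏.Env n) x (d d′ : pred (Dom ρ) x) i →
                     coord ρ x d i ≡ coord ρ x d′ i
  coord-irrelevant ρ x d d′ i = val-irrelevant (ρ i) x (d i) (d′ i)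

  ⟦_∣_⟧ : ∀ {n} → Pos n → ∏.Env n → Upset
  ⟦ ψ ∣ ρ ⟧ = record
    { pred = λ x → Σ (pred (Dom ρ) x) λ d → sat-at (coord ρ x d) ψ
    ; up = λ { {x} {y} x≤y (d , sψ) →
               up (Dom ρ) x≤y d ,
               sat-cong (std (M y)) (λ i → coh (ρ i) x≤y (d i) _) ψ
                 (sat-hom (f-hom x≤y) (coord ρ x d) ψ sψ) } }

  mutual
    ev-dom : ∀ {n} (ρ : ∏.Env n) {x} (d : pred (Dom ρ) x) t → pred (dom (∏.ev ρ t)) x
    ev-dom ρ d (var i) = d i
    ev-dom ρ d (fun g ts) = evs-dom ρ d ts

    evs-dom : ∀ {n k} (ρ : ∏.Env n) {x} (d : pred (Dom ρ) x) (ts : Vec (Term n) k) →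
              DomAll (∏.evs ρ ts) x
    evs-dom ρ d [] = tt
    evs-dom ρ d (t ∷ ts) = ev-dom ρ d t , evs-dom ρ d ts

  mutual
    ev-coord : ∀ {n} (ρ : ∏.Env n) {x} (d : pred (Dom ρ) x) t (e : pred (dom (∏.ev ρ t)) x) →
               val (∏.ev ρ t) x e ≡ ev-at (coord ρ x d) t
    ev-coord ρ {x} d (var i) e = val-irrelevant (ρ i) x e (d i)
    ev-coord ρ {x} d (fun g ts) e = cong (Structure.fn (M x) g) (evs-coord ρ d ts e)

    evs-coord : ∀ {n k} (ρ : ∏.Env n) {x} (d : pred (Dom ρ) x) (ts : Vec (Term n) k)
                (e : DomAll (∏.evs ρ ts) x) →
                evalAt x (∏.evs ρ ts) e ≡ evs-at (coord ρ x d) ts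
    evs-coord ρ d [] tt = refl
    evs-coord ρ d (t ∷ ts) (e , es) = cong₂ _∷_ (ev-coord ρ d t e) (evs-coord ρ d ts es)

  extend-coord : ∀ {n} (c : Elem) (ρ : ∏.Env n) {x} (d : pred (Dom (∏.extend c ρ)) x) i →
                 coord (∏.extend c ρ) x d i ≡
                 Sat.extend (std (M x)) (val c x (d zero)) (coord ρ x (λ j → d (suc j))) i
  extend-coord c ρ d zero = refl
  extend-coord c ρ d (suc i) = refl

  sat⇒⟦⟧∈F : ∀ {n} (ρ : ∏.Env n) ψ → ∏.sat ρ ψ → F ⟦ ψ ∣ ρ ⟧
  sat⇒⟦⟧∈F ρ (t ≐ s) (lift t≈s) = upward _ _ sub (meet _ _ t≈s (Dom∈F ρ))
    where
      sub : (⟦ ∏.ev ρ t ≐ ∏.ev ρ s ⟧ ∩ Dom ρ) ⊆ ⟦ t ≐ s ∣ ρ ⟧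
      sub x ((dt , ds , t≡s) , d) =
        d , lift (trans (sym (ev-coord ρ d t dt)) (trans t≡s (ev-coord ρ d s ds)))
  sat⇒⟦⟧∈F ρ (rel R ts) (lift r) = upward _ _ sub (meet _ _ r (Dom∈F ρ))
    where
      sub : (⟦rel R ⟧ (∏.evs ρ ts) ∩ Dom ρ) ⊆ ⟦ rel R ts ∣ ρ ⟧
      sub x ((dts , rx) , d) = d , lift (subst (Structure.rl (M x) R) (evs-coord ρ d ts dts) rx)
  sat⇒⟦⟧∈F ρ ⊥ᵖ (lift ())
  sat⇒⟦⟧∈F ρ (ψ ∧ᵖ χ) (sψ , sχ) =
    upward _ _ sub (meet _ _ (sat⇒⟦⟧∈F ρ ψ sψ) (sat⇒⟦⟧∈F ρ χ sχ))
    where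
      sub : (⟦ ψ ∣ ρ ⟧ ∩ ⟦ χ ∣ ρ ⟧) ⊆ ⟦ ψ ∧ᵖ χ ∣ ρ ⟧
      sub x ((d , sψx) , (d′ , sχx)) =
        d , sψx , sat-cong (std (M x)) (coord-irrelevant ρ x d′ d) χ sχx
  sat⇒⟦⟧∈F ρ (ψ ∨ᵖ χ) (inj₁ sψ) = upward _ _ (λ x (d , sψx) → d , inj₁ sψx) (sat⇒⟦⟧∈F ρ ψ sψ)
  sat⇒⟦⟧∈F ρ (ψ ∨ᵖ χ) (inj₂ sχ) = upward _ _ (λ x (d , sχx) → d , inj₂ sχx) (sat⇒⟦⟧∈F ρ χ sχ)
  sat⇒⟦⟧∈F ρ (∃ᵖ ψ) (c , sψ) = upward _ _ sub (sat⇒⟦⟧∈F (∏.extend c ρ) ψ sψ)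
    where
      sub : ⟦ ψ ∣ ∏.extend c ρ ⟧ ⊆ ⟦ ∃ᵖ ψ ∣ ρ ⟧
      sub x (d , sψx) =
        (λ i → d (suc i)) , val c x (d zero) , sat-cong (std (M x)) (extend-coord c ρ d) ψ sψx

module PrimeProduct
  (em : ExcludedMiddle (lsuc 0ℓ))
  (L : Signature) {X : Set} {_≤_ : X → X → Set} (po : IsPartialOrder _≡_ _≤_)
  (wff : Order.WellfoundedForest _≤_)
  (S : Systems.OrderedSystem L _≤_) (F : Order.Upset _≤_ → Set)
  (Fprime : Order.IsPrimeFilter _≤_ F) where
  open Syntax L
  open Order _≤_
  open IsPrimeFilter Fprime
  open IsFilter isFilter
  open Systems.OrderedSystem S
  open Systems.Product L _≤_ S F isFilter
  open SatisfactionProperties L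
  open FilterProduct L po S F isFilter
  open WellfoundedForestProperties em po wff
  open Classical em using (collapse; collapse-constant)
  open IsPartialOrder po using () renaming (trans to ≤-trans)

  module ExistsWitness {n} (ρ : ∏.Env n) (ψ : Pos (suc n)) (V∈F : F ⟦ ∃ᵖ ψ ∣ ρ ⟧) where
    open LeastBelow

    V : Upset
    V = ⟦ ∃ᵖ ψ ∣ ρ ⟧

    canonical : ∀ {m} → pred V m → pred V m
    canonical = collapse

    witnessAt : ∀ {m} → pred V m → C m
    witnessAt Vm = proj₁ (proj₂ (canonical Vm))

    witnessAt-transport : ∀ {u u′ z} → u ≡ u′ → (p : u ≤ z) (p′ : u′ ≤ z)
                          (Vu : pred V u) (Vu′ : pred V u′) →
                          f p (witnessAt Vu) ≡ f p′ (witnessAt Vu′)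
    witnessAt-transport refl p p′ Vu Vu′ =
      trans (f-irrelevant p p′ _) (cong (λ w → f p′ (proj₁ (proj₂ w))) (collapse-constant Vu Vu′))

    glue : ∀ x → pred V x → C x
    glue x Vx = f (point≤x Lx) (witnessAt (holds Lx))
      where
        Lx : LeastBelow (pred V) x
        Lx = leastBelow (pred V) Vx

    glue-coh : ∀ {y z} (y≤z : y ≤ z) (Vy : pred V y) (Vz : pred V z) →
               f y≤z (glue y Vy) ≡ glue z Vz
    glue-coh {y} {z} y≤z Vy Vz =
      trans (sym (f-comp (point≤x Ly) y≤z (≤-trans (point≤x Ly) y≤z) _))
            (witnessAt-transport (leastBelow-unique (pred V) y≤z Ly Lz)
               (≤-trans (point≤x Ly) y≤z) (point≤x Lz) (holds Ly) (holds Lz))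
      where
        Ly : LeastBelow (pred V) y
        Ly = leastBelow (pred V) Vy
        Lz : LeastBelow (pred V) z
        Lz = leastBelow (pred V) Vz

    witness : Elem
    witness = record { dom = V ; inF = V∈F ; val = glue ; coh = glue-coh }

    witness-sat : V ⊆ ⟦ ψ ∣ ∏.extend witness ρ ⟧
    witness-sat x Vx =
      d , sat-cong (std (M x)) pushed ψ (sat-hom (f-hom (point≤x Lx)) _ ψ sψ)
      where
        Lx : LeastBelow (pred V) x
        Lx = leastBelow (pred V) Vx
        m : X
        m = point Lx
        dm : pred (Dom ρ) m
        dm = proj₁ (canonical (holds Lx))
        sψ : sat-at (Sat.extend (std (M m)) (witnessAt (holds Lx)) (coord ρ m dm)) ψ
        sψ = proj₂ (proj₂ (canonical (holds Lx)))
        d : pred (Dom (∏.extend witness ρ)) x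
        d zero = Vx
        d (suc i) = proj₁ Vx i
        pushed : ∀ i → f (point≤x Lx) (Sat.extend (std (M m)) (witnessAt (holds Lx)) (coord ρ m dm) i)
                       ≡ coord (∏.extend witness ρ) x d i
        pushed zero = refl
        pushed (suc i) = coh (ρ i) (point≤x Lx) (dm i) (proj₁ Vx i)

  ⟦⟧∈F⇒sat : ∀ {n} (ρ : ∏.Env n) ψ → F ⟦ ψ ∣ ρ ⟧ → ∏.sat ρ ψ
  ⟦⟧∈F⇒sat ρ (t ≐ s) ⟦⟧∈F = lift (upward _ _ sub ⟦⟧∈F)
    where
      sub : ⟦ t ≐ s ∣ ρ ⟧ ⊆ ⟦ ∏.ev ρ t ≐ ∏.ev ρ s ⟧
      sub x (d , lift t≡s) =
        ev-dom ρ d t , ev-dom ρ d s ,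
        trans (ev-coord ρ d t _) (trans t≡s (sym (ev-coord ρ d s _)))
  ⟦⟧∈F⇒sat ρ (rel R ts) ⟦⟧∈F = lift (upward _ _ sub ⟦⟧∈F)
    where
      sub : ⟦ rel R ts ∣ ρ ⟧ ⊆ ⟦rel R ⟧ (∏.evs ρ ts)
      sub x (d , lift r) =
        evs-dom ρ d ts , subst (Structure.rl (M x) R) (sym (evs-coord ρ d ts _)) r
  ⟦⟧∈F⇒sat ρ ⊥ᵖ ⟦⟧∈F = ⊥-elim (proper (λ W → upward _ W (λ { _ (_ , lift ()) }) ⟦⟧∈F))
  ⟦⟧∈F⇒sat ρ (ψ ∧ᵖ χ) ⟦⟧∈F =
    ⟦⟧∈F⇒sat ρ ψ (upward _ _ (λ x (d , sψ , _) → d , sψ) ⟦⟧∈F) ,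
    ⟦⟧∈F⇒sat ρ χ (upward _ _ (λ x (d , _ , sχ) → d , sχ) ⟦⟧∈F)
  ⟦⟧∈F⇒sat ρ (ψ ∨ᵖ χ) ⟦⟧∈F with prime ⟦ ψ ∣ ρ ⟧ ⟦ χ ∣ ρ ⟧ (upward _ _ split ⟦⟧∈F)
    where
      split : ⟦ ψ ∨ᵖ χ ∣ ρ ⟧ ⊆ (⟦ ψ ∣ ρ ⟧ ∪ ⟦ χ ∣ ρ ⟧)
      split x (d , inj₁ sψ) = inj₁ (d , sψ)
      split x (d , inj₂ sχ) = inj₂ (d , sχ)
  ... | inj₁ ⟦ψ⟧∈F = inj₁ (⟦⟧∈F⇒sat ρ ψ ⟦ψ⟧∈F)
  ... | inj₂ ⟦χ⟧∈F = inj₂ (⟦⟧∈F⇒sat ρ χ ⟦χ⟧∈F)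
  ⟦⟧∈F⇒sat ρ (∃ᵖ ψ) ⟦⟧∈F =
    witness , ⟦⟧∈F⇒sat (∏.extend witness ρ) ψ (upward _ _ witness-sat ⟦⟧∈F)
    where open ExistsWitness ρ ψ ⟦⟧∈F

  satBasic-∏ : (β : BasicHInd) → (∀ x → Sat.satBasic (std (M x)) β) → ∏.satBasic β
  satBasic-∏ β holdsEverywhere ρ sHyp =
    ⟦⟧∈F⇒sat ρ concl (upward _ _ sub (sat⇒⟦⟧∈F ρ hyp sHyp))
    where
      open BasicHInd β
      sub : ⟦ hyp ∣ ρ ⟧ ⊆ ⟦ concl ∣ ρ ⟧
      sub x (d , sHypx) = d , holdsEverywhere x (coord ρ x d) sHypx

  ⊨-∏ : (φ : HInd) → (∀ x → std (M x) ⊨ φ) → ∏/F ⊨ φ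
  ⊨-∏ [] _ = All.[]
  ⊨-∏ (β ∷ φ) factors⊨ =
    satBasic-∏ β (λ x → All.head (factors⊨ x)) All.∷ ⊨-∏ φ (λ x → All.tail (factors⊨ x))

mainTheorem4 : ExcludedMiddle (lsuc 0ℓ) →
    (L : Signature) (X : Set) (_≤_ : X → X → Set) →
    IsPartialOrder _≡_ _≤_ →
    Order.WellfoundedForest _≤_ →
    (S : Systems.OrderedSystem L _≤_)
    (F : Order.Upset _≤_ → Set) (Fprime : Order.IsPrimeFilter _≤_ F)
    (φ : Syntax.HInd L) →
    (∀ x → Syntax._⊨_ L (Syntax.std L (Systems.OrderedSystem.M S x)) φ) →
    Syntax._⊨_ L (Systems.Product.∏/F L _≤_ S F (Order.IsPrimeFilter.isFilter Fprime)) φ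
mainTheorem4 em L X _≤_ po wff S F Fprime =
  PrimeProduct.⊨-∏ em L po wff S F Fprime
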